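{- Let $G$ be a connected graph. Then $$\frac{d_i+d_j}{d_i^2+d_j^2}=\frac{d_k+d_\ell}{d_k^2+d_\ell^2}\quad\text{for any two edges } v_iv_j,\,v_kv_\ell\in E(G)$$ if and only if $G$ is a regular graph, or $G$ is a semiregular bipartite graph, or $G\in\Gamma_3$.
   Context: $d_i$ is the degree of vertex $v_i$. A semiregular bipartite graph is a bipartite graph with bipartition $U,W$ in which all vertices of $U$ have a common degree $r$ and all vertices of $W$ have a common degree $s$. $\Gamma_3$ is the class of connected bipartite graphs $H$, with maximum degree $\Delta$, minimum degree $\delta$ and bipartition $V(H)=U\cup W$, such that every vertex of $U$ has degree $\Delta$ and every vertex of $W$ has degree $\delta$ or $\frac{\Delta(\Delta-\delta)}{\Delta+\delta}$. -}

module Defs where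

open import Data.Nat using (ℕ; _+_; _*_; _∸_; _≤_)
open import Data.Bool using (Bool; true; false; if_then_else_)
open import Data.Fin using (Fin)
open import Data.List using (map; allFin)
open import Data.Nat.ListAction using (sum)
open import Data.Product using (Σ; _×_; ∃; ∃-syntax)
open import Data.Sum using (_⊎_)
open import Relation.Binary.PropositionalEquality using (_≡_; _≢_)

record Graph (n : ℕ) : Set where
  field
    adj    : Fin n → Fin n → Bool
    sym    : ∀ i j → adj i j ≡ adj j i
    irrefl : ∀ i → adj i i ≡ false

module _ {n : ℕ} (G : Graph n) where
  open Graph G

  Edge : Fin n → Fin n → Set
  Edge i j = adj i j ≡ true

  deg : Fin n → ℕ
  deg i = sum (map (λ j → if adj i j then 1 else 0) (allFin n))

  data Reach : Fin n → Fin n → Set where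
    here  : ∀ {i} → Reach i i
    there : ∀ {i k j} → Edge i k → Reach k j → Reach i j

  Connected : Set
  Connected = ∀ i j → Reach i j

  -- (d_i+d_j)/(d_i^2+d_j^2) = (d_k+d_l)/(d_k^2+d_l^2), written as equality of
  -- fractions (cross-multiplication; denominators are positive on edges).
  ConstantRatio : Set
  ConstantRatio = ∀ i j k l → Edge i j → Edge k l →
    (deg i + deg j) * (deg k * deg k + deg l * deg l)
      ≡ (deg k + deg l) * (deg i * deg i + deg j * deg j)

  Regular : Set
  Regular = ∃[ r ] (∀ i → deg i ≡ r)

  -- side i ≡ true : i ∈ U ;  side i ≡ false : i ∈ W
  IsBipartition : (Fin n → Bool) → Set
  IsBipartition side = ∀ i j → Edge i j → side i ≢ side j

  SemiregularBipartite : Set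
  SemiregularBipartite = ∃[ side ] ∃[ r ] ∃[ s ]
    (IsBipartition side ×
     (∀ u → side u ≡ true → deg u ≡ r) ×
     (∀ w → side w ≡ false → deg w ≡ s))

  IsMaxDegree : ℕ → Set
  IsMaxDegree Δ = (∃[ i ] deg i ≡ Δ) × (∀ i → deg i ≤ Δ)

  IsMinDegree : ℕ → Set
  IsMinDegree δ = (∃[ i ] deg i ≡ δ) × (∀ i → δ ≤ deg i)

  -- G ∈ Γ₃.  "d = Δ(Δ-δ)/(Δ+δ)" is written d * (Δ+δ) ≡ Δ * (Δ-δ)
  -- (Δ ≥ δ, so truncated subtraction is exact).
  InΓ₃ : Set
  InΓ₃ = Connected × (∃[ Δ ] ∃[ δ ] ∃[ side ]
    (IsMaxDegree Δ × IsMinDegree δ × IsBipartition side ×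
     (∀ u → side u ≡ true → deg u ≡ Δ) ×
     (∀ w → side w ≡ false → deg w ≡ δ ⊎ deg w * (Δ + δ) ≡ Δ * (Δ ∸ δ))))

-- Write f(a, b) = (a + b)/(a² + b²). For fixed D, f(D, x) = f(D, y) holds iff x = y or
-- x and y are conjugate, xy + D(x + y) = D², and each x has at most one conjugate. Take a
-- vertex m of maximum degree Δ with a neighbour q. Every neighbour of a vertex of degree Δ
-- has degree d(q) or its conjugate. If d(q) = Δ this forces regularity. Otherwise such
-- neighbours have degree < Δ, and all neighbours of a vertex of degree < Δ that is adjacent
-- to a vertex of degree Δ have degree Δ; by connectivity "degree = Δ" is a bipartition whose
-- lower side takes only the degree d(q) and its conjugate, one of which is δ.
module Submission where

open import Defs
open import Data.Nat using (ℕ; zero; suc; _+_; _*_; _∸_; _≤_; _<_; _≟_)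
open import Data.Nat.Properties
open import Data.Nat.ListAction using (sum)
open import Data.Nat.Tactic.RingSolver using (solve-∀)
open import Data.Bool using (Bool; true; false; if_then_else_)
import Data.Bool.Properties as Bool
open import Data.Fin using (Fin)
import Data.Fin as Fin
open import Data.Fin.Properties using (any?)
open import Data.List using (_∷_; allFin)
open import Data.List.Extrema.Nat using (argmax; argmin; f[xs]≤f[argmax]; f[argmin]≤f[xs])
open import Data.List.Membership.Propositional using (_∈_)
open import Data.List.Membership.Propositional.Properties using (∈-allFin; ∈-map⁺)
import Data.List.Relation.Unary.All as All
open import Data.List.Relation.Unary.Any using (here; there)
open import Data.Product using (_×_; _,_; proj₁; proj₂; ∃-syntax)
open import Data.Sum using (_⊎_; inj₁; inj₂)
import Data.Sum as Sum
open import Data.Empty using (⊥-elim)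
open import Relation.Nullary using (does; proof; yes; no; contradiction)
open import Relation.Nullary.Reflects using (Reflects; invert)
open import Relation.Nullary.Decidable using (dec-true; dec-false)
open import Relation.Binary.PropositionalEquality

record SameRatio (a b c d : ℕ) : Set where
  constructor sameRatio
  field cross : (a + b) * (c * c + d * d) ≡ (c + d) * (a * a + b * b)

-- For x ≠ y, f(D, x) = f(D, y) is exactly this relation; with y = δ it reads
-- x = D(D − δ)/(D + δ), the second degree allowed in Γ₃.
record Conjugate (D x y : ℕ) : Set where
  constructor conjugate
  field square : x * y + D * (x + y) ≡ D * D

sameRatio-sym : ∀ {a b c d} → SameRatio a b c d → SameRatio c d a b
sameRatio-sym (sameRatio h) = sameRatio (sym h)

sameRatio-swapˡ : ∀ {a b c d} → SameRatio a b c d → SameRatio b a c d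
sameRatio-swapˡ {a} {b} {c} {d} (sameRatio h) = sameRatio
  (subst₂ (λ s t → s * (c * c + d * d) ≡ (c + d) * t) (+-comm a b) (+-comm (a * a) (b * b)) h)

sameRatio-swapʳ : ∀ {a b c d} → SameRatio a b c d → SameRatio a b d c
sameRatio-swapʳ {a} {b} {c} {d} (sameRatio h) = sameRatio
  (subst₂ (λ s t → (a + b) * t ≡ s * (a * a + b * b)) (+-comm c d) (+-comm (c * c) (d * d)) h)

conjugate-sym : ∀ {D x y} → Conjugate D x y → Conjugate D y x
conjugate-sym {D} {x} {y} (conjugate c) =
  conjugate (trans (cong₂ _+_ (*-comm y x) (cong (D *_) (+-comm y x))) c)

-- Cross-multiplying f(D, y) = f(D, y + k) leaves a difference k (D² − y(y + k) − D(2y + k)),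
-- written here with both sides moved so that no subtraction occurs.
sameRatio-gap : ∀ D y k →
  (D + y) * (D * D + (y + k) * (y + k)) + k * (D * D)
    ≡ (D + (y + k)) * (D * D + y * y) + k * (y * (y + k) + D * (y + (y + k)))
sameRatio-gap = solve-∀

sameRatio-+⇒≡⊎conjugate : ∀ D y k → SameRatio D y D (y + k) → y ≡ y + k ⊎ Conjugate D y (y + k)
sameRatio-+⇒≡⊎conjugate D y zero    h = inj₁ (sym (+-identityʳ y))
sameRatio-+⇒≡⊎conjugate D y (suc k) (sameRatio h) = inj₂ (conjugate (sym (*-cancelˡ-≡ _ _ (suc k)
  (+-cancelˡ-≡ ((D + (y + suc k)) * (D * D + y * y)) _ _
    (trans (cong (_+ suc k * (D * D)) (sym h)) (sameRatio-gap D y (suc k)))))))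

sameRatio⇒≡⊎conjugate : ∀ {D y x} → SameRatio D y D x → y ≡ x ⊎ Conjugate D y x
sameRatio⇒≡⊎conjugate {D} {y} {x} h with ≤-total y x
... | inj₁ y≤x with k , refl ← m≤n⇒∃[o]m+o≡n y≤x = sameRatio-+⇒≡⊎conjugate D y k h
... | inj₂ x≤y with k , refl ← m≤n⇒∃[o]m+o≡n x≤y =
  Sum.map sym conjugate-sym (sameRatio-+⇒≡⊎conjugate D x k (sameRatio-sym h))

conjugate-+⇒sameRatio : ∀ D y k → Conjugate D y (y + k) → SameRatio D y D (y + k)
conjugate-+⇒sameRatio D y k (conjugate c) = sameRatio (+-cancelʳ-≡ (k * (D * D)) _ _
  (trans (sameRatio-gap D y k) (cong (λ z → (D + (y + k)) * (D * D + y * y) + k * z) c)))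

conjugate⇒sameRatio : ∀ {D y x} → Conjugate D y x → SameRatio D y D x
conjugate⇒sameRatio {D} {y} {x} c with ≤-total y x
... | inj₁ y≤x with k , refl ← m≤n⇒∃[o]m+o≡n y≤x = conjugate-+⇒sameRatio D y k c
... | inj₂ x≤y with k , refl ← m≤n⇒∃[o]m+o≡n x≤y =
  sameRatio-sym (conjugate-+⇒sameRatio D x k (conjugate-sym c))

≡⊎conjugate⇒sameRatio : ∀ {D y x} → y ≡ x ⊎ Conjugate D y x → SameRatio D y D x
≡⊎conjugate⇒sameRatio (inj₁ refl) = sameRatio refl
≡⊎conjugate⇒sameRatio (inj₂ c)    = conjugate⇒sameRatio c

conjugate⇒< : ∀ {D x y} → 1 ≤ D → 1 ≤ x → Conjugate D x y → y < D
conjugate⇒< {D} {x} {y} 1≤D 1≤x (conjugate c) with y <? D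
... | yes y<D = y<D
... | no  y≮D = contradiction c (>⇒≢ (begin-strict
  D * D              <⟨ +-monoˡ-< (D * D) (*-mono-≤ 1≤D 1≤x) ⟩
  D * x + D * D      ≤⟨ +-monoʳ-≤ (D * x) (*-monoʳ-≤ D (≮⇒≥ y≮D)) ⟩
  D * x + D * y      ≡⟨ *-distribˡ-+ D x y ⟨
  D * (x + y)        ≤⟨ m≤n+m (D * (x + y)) (x * y) ⟩
  x * y + D * (x + y) ∎))
  where open ≤-Reasoning

square-split : ∀ {D d} → d ≤ D → D * (D ∸ d) + D * d ≡ D * D
square-split {D} {d} d≤D = trans (sym (*-distribˡ-+ D (D ∸ d) d)) (cong (D *_) (m∸n+n≡m d≤D))

conjugate-linear : ∀ D d x → x * (D + d) + D * d ≡ x * d + D * (x + d)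
conjugate-linear = solve-∀

conjugate⇒quotient : ∀ {D d x} → d ≤ D → Conjugate D x d → x * (D + d) ≡ D * (D ∸ d)
conjugate⇒quotient {D} {d} {x} d≤D (conjugate c) = +-cancelʳ-≡ (D * d) _ _
  (trans (conjugate-linear D d x) (trans c (sym (square-split d≤D))))

quotient⇒conjugate : ∀ {D d x} → d ≤ D → x * (D + d) ≡ D * (D ∸ d) → Conjugate D x d
quotient⇒conjugate {D} {d} {x} d≤D q = conjugate (trans (sym (conjugate-linear D d x))
  (trans (cong (_+ D * d) q) (square-split d≤D)))

conjugate-unique : ∀ {D x y z} → 1 ≤ D → Conjugate D y x → Conjugate D z x → y ≡ z
conjugate-unique {suc D} {x} {y} {z} _ (conjugate cy) (conjugate cz) =
  *-cancelʳ-≡ y z (suc D + x) (+-cancelʳ-≡ (suc D * x) _ _ (begin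
    y * (suc D + x) + suc D * x   ≡⟨ conjugate-linear (suc D) x y ⟩
    y * x + suc D * (y + x)       ≡⟨ trans cy (sym cz) ⟩
    z * x + suc D * (z + x)       ≡⟨ conjugate-linear (suc D) x z ⟨
    z * (suc D + x) + suc D * x   ∎))
  where open ≡-Reasoning

conjugate-pair : ∀ {D a b x} → 1 ≤ D → a ≡ x ⊎ Conjugate D a x → b ≡ x ⊎ Conjugate D b x
               → a ≡ b ⊎ Conjugate D a b
conjugate-pair _   (inj₁ refl) (inj₁ refl) = inj₁ refl
conjugate-pair _   (inj₁ refl) (inj₂ cb)   = inj₂ (conjugate-sym cb)
conjugate-pair _   (inj₂ ca)   (inj₁ refl) = inj₂ ca
conjugate-pair 1≤D (inj₂ ca)   (inj₂ cb)   = inj₁ (conjugate-unique 1≤D ca cb)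

∈⇒≤sum : ∀ {x xs} → x ∈ xs → x ≤ sum xs
∈⇒≤sum {xs = y ∷ ys} (here refl) = m≤m+n y (sum ys)
∈⇒≤sum {xs = y ∷ ys} (there x∈ys) = ≤-trans (∈⇒≤sum x∈ys) (m≤n+m (sum ys) y)

module _ {n : ℕ} (G : Graph n) where
  open Graph G using (adj)

  edge-sym : ∀ {i j} → Edge G i j → Edge G j i
  edge-sym {i} {j} e = trans (Graph.sym G j i) e

  edge⇒1≤deg : ∀ {i j} → Edge G i j → 1 ≤ deg G i
  edge⇒1≤deg {i} {j} e = subst (λ b → (if b then 1 else 0) ≤ deg G i) e
    (∈⇒≤sum (∈-map⁺ (λ k → if adj i k then 1 else 0) (∈-allFin j)))

  transport-along : (P : Fin n → Set) → (∀ {i j} → Edge G i j → P i → P j)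
                  → ∀ {i j} → Reach G i j → P i → P j
  transport-along P step here          p = p
  transport-along P step (there e ij) p = transport-along P step ij (step e p)

  max-degree-vertex : Fin n → ∃[ m ] (∀ j → deg G j ≤ deg G m)
  max-degree-vertex v = argmax (deg G) v (allFin n) ,
    λ j → All.lookup (f[xs]≤f[argmax] v (allFin n)) (∈-allFin j)

  min-degree-vertex : Fin n → ∃[ μ ] (∀ j → deg G μ ≤ deg G j)
  min-degree-vertex v = argmin (deg G) v (allFin n) ,
    λ j → All.lookup (f[argmin]≤f[xs] v (allFin n)) (∈-allFin j)

  CrossingRatiosAgree : (Fin n → Bool) → Set
  CrossingRatiosAgree side = ∀ {u w u′ w′} →
    side u ≡ true → side w ≡ false → Edge G u w →
    side u′ ≡ true → side w′ ≡ false → Edge G u′ w′ →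
    SameRatio (deg G u) (deg G w) (deg G u′) (deg G w′)

  module _ {side : Fin n → Bool} (bip : IsBipartition G side) where

    orient : ∀ {i j} → Edge G i j
           → (side i ≡ true × side j ≡ false) ⊎ (side j ≡ true × side i ≡ false)
    orient {i} {j} e with side i in si | side j in sj
    ... | true  | false = inj₁ (refl , refl)
    ... | false | true  = inj₂ (refl , refl)
    ... | true  | true  = ⊥-elim (bip i j e (trans si (sym sj)))
    ... | false | false = ⊥-elim (bip i j e (trans si (sym sj)))

    crossing⇒constantRatio : CrossingRatiosAgree side → ConstantRatio G
    crossing⇒constantRatio agree i j k l ij kl = SameRatio.cross (oriented (orient ij) (orient kl))
      where
      oriented : (side i ≡ true × side j ≡ false) ⊎ (side j ≡ true × side i ≡ false)
               → (side k ≡ true × side l ≡ false) ⊎ (side l ≡ true × side k ≡ false)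
               → SameRatio (deg G i) (deg G j) (deg G k) (deg G l)
      oriented (inj₁ (si , sj)) (inj₁ (sk , sl)) = agree si sj ij sk sl kl
      oriented (inj₁ (si , sj)) (inj₂ (sl , sk)) = sameRatio-swapʳ (agree si sj ij sl sk (edge-sym kl))
      oriented (inj₂ (sj , si)) (inj₁ (sk , sl)) = sameRatio-swapˡ (agree sj si (edge-sym ij) sk sl kl)
      oriented (inj₂ (sj , si)) (inj₂ (sl , sk)) =
        sameRatio-swapˡ (sameRatio-swapʳ (agree sj si (edge-sym ij) sl sk (edge-sym kl)))

  regular⇒constantRatio : Regular G → ConstantRatio G
  regular⇒constantRatio (r , deg≡r) i j k l _ _
    rewrite deg≡r i | deg≡r j | deg≡r k | deg≡r l = refl

  semiregular⇒constantRatio : SemiregularBipartite G → ConstantRatio G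
  semiregular⇒constantRatio (side , r , s , bip , degU , degW) = crossing⇒constantRatio bip agree
    where
    agree : CrossingRatiosAgree side
    agree {u} {w} {u′} {w′} su sw _ su′ sw′ _
      rewrite degU u su | degW w sw | degU u′ su′ | degW w′ sw′ = sameRatio refl

  Γ₃⇒constantRatio : InΓ₃ G → ConstantRatio G
  Γ₃⇒constantRatio (_ , Δ , δ , side , (_ , maxΔ) , ((μ , _) , minδ) , bip , degU , degW) =
    crossing⇒constantRatio bip agree
    where
    W-degree : ∀ {w} → side w ≡ false → deg G w ≡ δ ⊎ Conjugate Δ (deg G w) δ
    W-degree {w} sw = Sum.map₂ (quotient⇒conjugate (≤-trans (minδ μ) (maxΔ μ))) (degW w sw)

    agree : CrossingRatiosAgree side
    agree {u} {w} {u′} {w′} su sw uw su′ sw′ _ rewrite degU u su | degU u′ su′ =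
      ≡⊎conjugate⇒sameRatio
        (conjugate-pair (≤-trans (edge⇒1≤deg uw) (maxΔ u)) (W-degree sw) (W-degree sw′))

  classes⇒constantRatio : Regular G ⊎ SemiregularBipartite G ⊎ InΓ₃ G → ConstantRatio G
  classes⇒constantRatio (inj₁ reg)         = regular⇒constantRatio reg
  classes⇒constantRatio (inj₂ (inj₁ semi)) = semiregular⇒constantRatio semi
  classes⇒constantRatio (inj₂ (inj₂ γ))    = Γ₃⇒constantRatio γ

module _ {n : ℕ} (G : Graph n) (conn : Connected G) (cr : ConstantRatio G) where

  neighbour-degrees : ∀ {v k v′ k′} → Edge G v k → Edge G v′ k′ → deg G v ≡ deg G v′
                    → deg G k ≡ deg G k′ ⊎ Conjugate (deg G v′) (deg G k) (deg G k′)
  neighbour-degrees {v} {k} {v′} {k′} vk v′k′ v≡v′ = sameRatio⇒≡⊎conjugate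
    (subst (λ D → SameRatio D (deg G k) (deg G v′) (deg G k′)) v≡v′ (sameRatio (cr _ _ _ _ vk v′k′)))

  module FromMaxDegreeEdge {m q : Fin n} (maxΔ : ∀ j → deg G j ≤ deg G m) (mq : Edge G m q) where
    Δ x : ℕ
    Δ = deg G m
    x = deg G q

    1≤Δ : 1 ≤ Δ
    1≤Δ = edge⇒1≤deg G mq

    Δ-neighbour : ∀ {v k} → deg G v ≡ Δ → Edge G v k → deg G k ≡ x ⊎ Conjugate Δ (deg G k) x
    Δ-neighbour v≡Δ vk = neighbour-degrees vk mq v≡Δ

    regular : x ≡ Δ → Regular G
    regular x≡Δ = Δ , λ j → transport-along G (λ v → deg G v ≡ Δ) step (conn m j) refl
      where
      step : ∀ {v k} → Edge G v k → deg G v ≡ Δ → deg G k ≡ Δ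
      step {v} {k} vk v≡Δ with Δ-neighbour v≡Δ vk
      ... | inj₁ k≡x = trans k≡x x≡Δ
      ... | inj₂ c   = ⊥-elim (<-irrefl refl
        (conjugate⇒< 1≤Δ (edge⇒1≤deg G (edge-sym G vk)) (subst (Conjugate Δ (deg G k)) x≡Δ c)))

    module Irregular (x<Δ : x < Δ) where
      InU InW : Fin n → Set
      InU v = deg G v ≡ Δ
      InW v = deg G v < Δ × ∃[ u ] (Edge G v u × InU u)

      U-neighbour<Δ : ∀ {v k} → InU v → Edge G v k → deg G k < Δ
      U-neighbour<Δ v∈U vk with Δ-neighbour v∈U vk
      ... | inj₁ k≡x = subst (_< Δ) (sym k≡x) x<Δ
      ... | inj₂ c   = conjugate⇒< 1≤Δ (edge⇒1≤deg G (edge-sym G mq)) (conjugate-sym c)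

      W-neighbour∈U : ∀ {w z} → InW w → Edge G w z → InU z
      W-neighbour∈U {w} (w<Δ , u , wu , u∈U) wz with neighbour-degrees wz wu refl
      ... | inj₁ z≡u = trans z≡u u∈U
      ... | inj₂ c   = ⊥-elim (<-asym w<Δ (subst (_< deg G w) u∈U
        (conjugate⇒< (edge⇒1≤deg G wz) (edge⇒1≤deg G (edge-sym G wz)) c)))

      U⊎W : ∀ v → InU v ⊎ InW v
      U⊎W v = transport-along G (λ v → InU v ⊎ InW v) step (conn m v) (inj₁ refl)
        where
        step : ∀ {v k} → Edge G v k → InU v ⊎ InW v → InU k ⊎ InW k
        step vk (inj₁ v∈U) = inj₂ (U-neighbour<Δ v∈U vk , _ , edge-sym G vk , v∈U)
        step vk (inj₂ v∈W) = inj₁ (W-neighbour∈U v∈W vk)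

      side : Fin n → Bool
      side v = does (deg G v ≟ Δ)

      side-U : ∀ {v} → InU v → side v ≡ true
      side-U {v} = dec-true (deg G v ≟ Δ)

      side-< : ∀ {v} → deg G v < Δ → side v ≡ false
      side-< {v} v<Δ = dec-false (deg G v ≟ Δ) (<⇒≢ v<Δ)

      side-true⇒U : ∀ {v} → side v ≡ true → InU v
      side-true⇒U {v} s = invert (subst (Reflects (InU v)) s (proof (deg G v ≟ Δ)))

      side-false⇒W : ∀ {v} → side v ≡ false → InW v
      side-false⇒W {v} s with U⊎W v
      ... | inj₁ v∈U = contradiction (trans (sym (side-U v∈U)) s) λ ()
      ... | inj₂ v∈W = v∈W

      bipartition : IsBipartition G side
      bipartition i j ij si≡sj with U⊎W i
      ... | inj₁ i∈U = contradiction
        (trans (sym (side-U i∈U)) (trans si≡sj (side-< (U-neighbour<Δ i∈U ij)))) λ ()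
      ... | inj₂ i∈W@(i<Δ , _) = contradiction
        (trans (sym (side-< i<Δ)) (trans si≡sj (side-U (W-neighbour∈U i∈W ij)))) λ ()

      W-degree : ∀ {w} → InW w → deg G w ≡ x ⊎ Conjugate Δ (deg G w) x
      W-degree (_ , _ , wu , u∈U) = Δ-neighbour u∈U (edge-sym G wu)

      Γ₃ : InΓ₃ G
      Γ₃ = conn , Δ , δ , side , ((m , refl) , maxΔ) , ((μ , refl) , minδ) , bipartition ,
           (λ _ → side-true⇒U) , W-degree-δ
        where
        μ : Fin n
        μ = proj₁ (min-degree-vertex G m)

        minδ : ∀ j → deg G μ ≤ deg G j
        minδ = proj₂ (min-degree-vertex G m)

        δ : ℕ
        δ = deg G μ

        μ∈W : InW μ
        μ∈W = side-false⇒W (side-< (≤-<-trans (minδ q) x<Δ))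

        W-degree-δ : ∀ w → side w ≡ false → deg G w ≡ δ ⊎ deg G w * (Δ + δ) ≡ Δ * (Δ ∸ δ)
        W-degree-δ w sw = Sum.map₂ (conjugate⇒quotient (maxΔ μ))
          (conjugate-pair 1≤Δ (W-degree (side-false⇒W sw)) (W-degree μ∈W))

  classes-from-max-degree : ∀ {m} → (∀ j → deg G j ≤ deg G m)
                          → Regular G ⊎ SemiregularBipartite G ⊎ InΓ₃ G
  classes-from-max-degree {m} maxΔ with any? (λ j → Graph.adj G m j Bool.≟ true)
  ... | no isolated = inj₁ (deg G m , λ j → cong (deg G) (transport-along G (_≡ m) stay (conn m j) refl))
    where
    stay : ∀ {v k} → Edge G v k → v ≡ m → k ≡ m
    stay vk refl = ⊥-elim (isolated (_ , vk))
  ... | yes (q , mq) with deg G q ≟ deg G m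
  ...   | yes q≡Δ = inj₁ (FromMaxDegreeEdge.regular maxΔ mq q≡Δ)
  ...   | no  q≢Δ = inj₂ (inj₂ (FromMaxDegreeEdge.Irregular.Γ₃ maxΔ mq (≤∧≢⇒< (maxΔ q) q≢Δ)))

constantRatio⇒classes : ∀ {n} (G : Graph n) → Connected G → ConstantRatio G
                      → Regular G ⊎ SemiregularBipartite G ⊎ InΓ₃ G
constantRatio⇒classes {zero}  G conn cr = inj₁ (0 , λ ())
constantRatio⇒classes {suc n} G conn cr =
  classes-from-max-degree G conn cr (proj₂ (max-degree-vertex G Fin.zero))

lemma3p6 : {n : ℕ} (G : Graph n) → Connected G →
    ((ConstantRatio G → Regular G ⊎ SemiregularBipartite G ⊎ InΓ₃ G) ×
     (Regular G ⊎ SemiregularBipartite G ⊎ InΓ₃ G → ConstantRatio G))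
lemma3p6 G conn = constantRatio⇒classes G conn , classes⇒constantRatio G
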